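{- Let $f:\mathbb{N}\to\mathbb{N}$ be a nondecreasing function, let $c\in\mathbb{N}$ and let $Q$ be a tournament. Then there exists $C$, depending only on $f$, $c$ and $|V(Q)|$, such that for every tournament $T$ one of the following holds: (a) $\overrightarrow{\omega}(T)<C$; (b) $T$ contains a copy of $Q$; or (c) there exist an integer $x\geq c$ and two disjoint sets $A,B\subseteq V(T)$ such that $\overrightarrow{\omega}(A)=\overrightarrow{\omega}(B)=f(x)$, and either $\overrightarrow{\omega}(N^-(v)\cap B)<x$ for every $v\in A$, or $\overrightarrow{\omega}(N^+(v)\cap B)<x$ for every $v\in A$.
   Context: A tournament is a finite directed graph with exactly one arc between each pair of distinct vertices; $N^+(v)$, $N^-(v)$ denote out- and in-neighbourhoods. For a total ordering $<$ of $V(T)$, the backedge graph $B(T,<)$ is the graph on $V(T)$ with an edge $uv$ for every pair $u<v$ with $vu \in A(T)$; $\overrightarrow{\omega}(T)=\min_<\omega(B(T,<))$ over all total orderings, and for $X\subseteq V(T)$, $\overrightarrow{\omega}(X)=\overrightarrow{\omega}(T[X])$. $T$ contains a copy of $Q$ if some induced subtournament of $T$ is isomorphic to $Q$. -}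

module Defs where

open import Data.Nat using (ℕ; _<_; _≤_)
open import Data.Bool using (Bool; true; false; not)
open import Data.Fin using (Fin)
open import Data.Fin.Subset using (Subset; _∈_; _∉_; _⊆_; _∩_; ∣_∣)
open import Data.Vec using (tabulate)
open import Data.Product using (Σ; _×_; ∃)
open import Relation.Binary.PropositionalEquality using (_≡_; _≢_)

record Tournament (n : ℕ) : Set where
  field
    adj     : Fin n → Fin n → Bool
    irrefl  : ∀ v → adj v v ≡ false
    oneArc  : ∀ u v → u ≢ v → adj u v ≡ not (adj v u)

open Tournament public

Arc : ∀ {n} → Tournament n → Fin n → Fin n → Set
Arc T u v = adj T u v ≡ true

N⁺ : ∀ {n} → Tournament n → Fin n → Subset n
N⁺ T v = tabulate (λ u → adj T v u)

N⁻ : ∀ {n} → Tournament n → Fin n → Subset n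
N⁻ T v = tabulate (λ u → adj T u v)

-- A total ordering of X ⊆ V(T), given by a rank function injective on X
-- (u < v in the ordering iff rank u < rank v).
IsOrderingOf : ∀ {n} → Subset n → (Fin n → ℕ) → Set
IsOrderingOf X r = ∀ u v → u ∈ X → v ∈ X → r u ≡ r v → u ≡ v

-- K is a clique of the backedge graph B(T[X], r):
-- K ⊆ X and every pair u < v in K has the arc vu.
BackClique : ∀ {n} → Tournament n → Subset n → (Fin n → ℕ) → Subset n → Set
BackClique T X r K = K ⊆ X × (∀ u v → u ∈ K → v ∈ K → r u < r v → Arc T v u)

CliqueNumLe : ∀ {n} → Tournament n → Subset n → (Fin n → ℕ) → ℕ → Set
CliqueNumLe T X r k = ∀ K → BackClique T X r K → ∣ K ∣ ≤ k

OmegaLe : ∀ {n} → Tournament n → Subset n → ℕ → Set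
OmegaLe {n} T X k = Σ (Fin n → ℕ) λ r → IsOrderingOf X r × CliqueNumLe T X r k

OmegaLt : ∀ {n} → Tournament n → Subset n → ℕ → Set
OmegaLt T X k = Σ ℕ λ j → j < k × OmegaLe T X j

-- ω→(X) = m : some ordering has backedge clique number ≤ m, and every
-- ordering has a backedge clique of size ≥ m (so the minimum is exactly m).
OmegaEq : ∀ {n} → Tournament n → Subset n → ℕ → Set
OmegaEq {n} T X m =
  OmegaLe T X m ×
  (∀ (r : Fin n → ℕ) → IsOrderingOf X r → Σ (Subset n) λ K → BackClique T X r K × m ≤ ∣ K ∣)

Full : ∀ {n} → Subset n
Full = tabulate (λ _ → true)

ContainsCopy : ∀ {n q} → Tournament n → Tournament q → Set
ContainsCopy {n} {q} T Q =
  Σ (Fin q → Fin n) λ φ → (∀ i j → φ i ≡ φ j → i ≡ j) × (∀ i j → adj T (φ i) (φ j) ≡ adj Q i j)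

Disjoint : ∀ {n} → Subset n → Subset n → Set
Disjoint A B = ∀ v → v ∈ A → v ∉ B

Nondecreasing : (ℕ → ℕ) → Set
Nondecreasing f = ∀ {a b} → a ≤ b → f a ≤ f b

module Submission where

-- Write ω for ω→. It is monotone, subadditive under unions and drops by at most one when a
-- vertex is deleted, so every value below ω(X) is the ω of a subset of X. If ω(T) ≥ q·N_q,
-- where N_s = bound s, split V(T) into disjoint S₀, …, S_{q-1} with ω(S_j) ≥ N_q and embed Q
-- with vertex j in S_j as follows. Put x = N_{q-1} + c, shrink S₁, …, S_{q-1} to sets B_j with
-- ω(B_j) = f(x), and call v ∈ S₀ sparse for j if ω of its neighbourhood in B_j, on the side
-- that Q prescribes for the arc between 0 and j, is below x. If the vertices sparse for some j
-- have ω ≥ f(x), they and B_j give outcome (c). Otherwise q − 1 sets of ω < f(x) cannot cover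
-- S₀, so some v ∈ S₀ is sparse for no j; map vertex 0 of Q to v and recurse inside its
-- prescribed neighbourhoods in the B_j, each of ω ≥ x ≥ N_{q-1}.

open import Defs
open import Data.Bool using (Bool; true; false; not)
open import Data.Bool.Properties using () renaming (_≟_ to _≟ᵇ_)
open import Data.Fin using (Fin; zero; suc; toℕ; fromℕ<; finToFun; funToFin)
import Data.Fin.Properties as Fin
open import Data.Fin.Properties
  using (any?; all?; toℕ-injective; toℕ-fromℕ<; finToFun-funToFin) renaming (_≟_ to _≟ᶠ_)
open import Data.Fin.Subset using (Subset; _∈_; _∉_; _⊆_; _∩_; _∪_; ∁; _-_; ∣_∣; ⊥; ⁅_⁆; Nonempty)
open import Data.Fin.Subset.Properties
open import Data.Nat using (ℕ; zero; suc; _+_; _*_; _^_; _≤_; _<_; z≤n; s≤s; s<s)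
open import Data.Nat.Properties
open import Data.Product using (Σ; ∃; _×_; _,_; proj₁; proj₂)
open import Data.Sum using (_⊎_; inj₁; inj₂; [_,_]′; map₂)
open import Data.Vec using (_∷_; []; tabulate)
open import Data.Vec.Functional using (tail) renaming (_∷_ to _∷ᶠ_)
open import Data.Vec.Properties using (lookup∘tabulate; []=⇒lookup; lookup⇒[]=)
open import Function using (_∘_; id)
open import Relation.Binary.Definitions using (tri<; tri≈; tri>)
open import Relation.Binary.PropositionalEquality
open import Relation.Nullary using (¬_; ¬?; Dec; yes; no; does; contradiction)
open import Relation.Nullary.Decidable using (map′; _×-dec_; _→-dec_; dec-true; decidable-stable)
open import Level using (0ℓ)
open import Relation.Unary using (Pred; Decidable)

∣p∪q∣≤∣p∣+∣q∣ : ∀ {n} (p q : Subset n) → ∣ p ∪ q ∣ ≤ ∣ p ∣ + ∣ q ∣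
∣p∪q∣≤∣p∣+∣q∣ []          []      = z≤n
∣p∪q∣≤∣p∣+∣q∣ (true  ∷ p) (b ∷ q) = s≤s (≤-trans (∣p∪q∣≤∣p∣+∣q∣ p q) (+-monoʳ-≤ ∣ p ∣ (∣p∣≤∣x∷p∣ b q)))
∣p∪q∣≤∣p∣+∣q∣ (false ∷ p) (true  ∷ q) =
  ≤-trans (s≤s (∣p∪q∣≤∣p∣+∣q∣ p q)) (≤-reflexive (sym (+-suc ∣ p ∣ ∣ q ∣)))
∣p∪q∣≤∣p∣+∣q∣ (false ∷ p) (false ∷ q) = ∣p∪q∣≤∣p∣+∣q∣ p q

p⊆p∩q∪p∩∁q : ∀ {n} (p q : Subset n) → p ⊆ (p ∩ q) ∪ (p ∩ ∁ q)
p⊆p∩q∪p∩∁q p q {x} x∈p with x ∈? q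
... | yes x∈q = x∈p∪q⁺ (inj₁ (x∈p∩q⁺ (x∈p , x∈q)))
... | no  x∉q = x∈p∪q⁺ (inj₂ (x∈p∩q⁺ (x∈p , x∉p⇒x∈∁p x∉q)))

x∈p∪q∧x∉p⇒x∈q : ∀ {n} {p q : Subset n} {x} → x ∈ p ∪ q → x ∉ p → x ∈ q
x∈p∪q∧x∉p⇒x∈q {p = p} {q} x∈p∪q x∉p = [ (λ x∈p → contradiction x∈p x∉p) , id ]′ (x∈p∪q⁻ p q x∈p∪q)

∈-tabulate⁺ : ∀ {n} (g : Fin n → Bool) {x} → g x ≡ true → x ∈ tabulate g
∈-tabulate⁺ g {x} gx = lookup⇒[]= x (tabulate g) (trans (lookup∘tabulate g x) gx)

∈-tabulate⁻ : ∀ {n} (g : Fin n → Bool) {x} → x ∈ tabulate g → g x ≡ true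
∈-tabulate⁻ g {x} x∈ = trans (sym (lookup∘tabulate g x)) ([]=⇒lookup x∈)

module _ {n} {P : Pred (Fin n) 0ℓ} (P? : Decidable P) where

  subset : Subset n
  subset = tabulate (does ∘ P?)

  ∈-subset⁺ : ∀ {x} → P x → x ∈ subset
  ∈-subset⁺ {x} px = ∈-tabulate⁺ (does ∘ P?) (dec-true (P? x) px)

  ∈-subset⁻ : ∀ {x} → x ∈ subset → P x
  ∈-subset⁻ {x} x∈ with P? x | ∈-tabulate⁻ (does ∘ P?) x∈
  ... | yes px | _ = px

module _ {P : Pred ℕ 0ℓ} (P? : Decidable P) where

  Least : ℕ → Set
  Least m = P m × (∀ j → j < m → ¬ P j)

  private
    search : ∀ N → (∀ j → j < N → ¬ P j) ⊎ ∃ Least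
    search zero = inj₁ λ _ ()
    search (suc N) with search N
    ... | inj₂ least = inj₂ least
    ... | inj₁ none with P? N
    ...   | yes pN = inj₂ (N , pN , none)
    ...   | no ¬pN = inj₁ λ j j<1+N → [ none j , (λ { refl → ¬pN }) ]′ (m<1+n⇒m<n∨m≡n j<1+N)

  least : ∀ {N} → P N → ∃ Least
  least {N} pN = [ (λ none → contradiction pN (none N ≤-refl)) , id ]′ (search (suc N))

IsOrderingOf-⊆ : ∀ {n} {X Y : Subset n} {r} → Y ⊆ X → IsOrderingOf X r → IsOrderingOf Y r
IsOrderingOf-⊆ Y⊆X ord u v u∈Y v∈Y = ord u v (Y⊆X u∈Y) (Y⊆X v∈Y)

isOrderingOf? : ∀ {n} (X : Subset n) r → Dec (IsOrderingOf X r)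
isOrderingOf? X r = all? λ u → all? λ v →
  (u ∈? X) →-dec ((v ∈? X) →-dec ((r u ≟ r v) →-dec (u ≟ᶠ v)))

IsOrderingOf-rerank : ∀ {n} {X : Subset n} {r s} → (∀ {u v} → u ∈ X → v ∈ X → r u < r v → s u < s v) →
                      IsOrderingOf X r → IsOrderingOf X s
IsOrderingOf-rerank {r = r} mono ord u v u∈X v∈X su≡sv with <-cmp (r u) (r v)
... | tri< ru<rv _ _ = contradiction su≡sv (<⇒≢ (mono u∈X v∈X ru<rv))
... | tri≈ _ ru≡rv _ = ord u v u∈X v∈X ru≡rv
... | tri> _ _ rv<ru = contradiction (sym su≡sv) (<⇒≢ (mono v∈X u∈X rv<ru))

module _ {n : ℕ} where

  below : (Fin n → ℕ) → Fin n → Subset n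
  below r v = subset (λ w → r w <? r v)

  rank : Subset n → (Fin n → ℕ) → Fin n → ℕ
  rank X r v = ∣ X ∩ below r v ∣

  rank-mono : ∀ {X r u v} → u ∈ X → r u < r v → rank X r u < rank X r v
  rank-mono {X} {r} {u} {v} u∈X ru<rv =
    p⊂q⇒∣p∣<∣q∣ (below-u⊆below-v , u , x∈p∩q⁺ (u∈X , ∈-subset⁺ (λ w → r w <? r v) ru<rv) , u∉below-u)
    where
    below-u⊆below-v : X ∩ below r u ⊆ X ∩ below r v
    below-u⊆below-v w∈ with x∈p∩q⁻ X (below r u) w∈
    ... | w∈X , rw<ru = x∈p∩q⁺ (w∈X , ∈-subset⁺ (λ w → r w <? r v)
                                        (<-trans (∈-subset⁻ (λ w → r w <? r u) rw<ru) ru<rv))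
    u∉below-u : u ∉ X ∩ below r u
    u∉below-u u∈ = <-irrefl refl (∈-subset⁻ (λ w → r w <? r u) (proj₂ (x∈p∩q⁻ X (below r u) u∈)))

module _ {n : ℕ} (X : Subset n) (r s : Fin n → ℕ) where

  interleave : Fin n → ℕ
  interleave v with v ∈? X
  ... | yes _ = 2 * r v
  ... | no  _ = suc (2 * s v)

  interleave-∈ : ∀ {v} → v ∈ X → interleave v ≡ 2 * r v
  interleave-∈ {v} v∈X with v ∈? X
  ... | yes _   = refl
  ... | no v∉X = contradiction v∈X v∉X

  interleave-∉ : ∀ {v} → v ∉ X → interleave v ≡ suc (2 * s v)
  interleave-∉ {v} v∉X with v ∈? X
  ... | yes v∈X = contradiction v∈X v∉X
  ... | no _    = refl

  interleave-mono-∈ : ∀ {u v} → u ∈ X → v ∈ X → r u < r v → interleave u < interleave v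
  interleave-mono-∈ u∈X v∈X ru<rv =
    subst₂ _<_ (sym (interleave-∈ u∈X)) (sym (interleave-∈ v∈X)) (*-monoʳ-< 2 ru<rv)

  interleave-mono-∉ : ∀ {u v} → u ∉ X → v ∉ X → s u < s v → interleave u < interleave v
  interleave-mono-∉ u∉X v∉X su<sv =
    subst₂ _<_ (sym (interleave-∉ u∉X)) (sym (interleave-∉ v∉X)) (s<s (*-monoʳ-< 2 su<sv))

  IsOrderingOf-interleave : ∀ {Y} → IsOrderingOf X r → IsOrderingOf Y s → IsOrderingOf (X ∪ Y) interleave
  IsOrderingOf-interleave ordX ordY u v u∈ v∈ eq with u ∈? X | v ∈? X
  ... | yes u∈X | yes v∈X = ordX u v u∈X v∈X (*-cancelˡ-≡ (r u) (r v) 2 eq)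
  ... | yes _   | no _    = contradiction eq (even≢odd (r u) (s v))
  ... | no _    | yes _   = contradiction (sym eq) (even≢odd (r v) (s u))
  ... | no u∉X  | no v∉X  = ordY u v (x∈p∪q∧x∉p⇒x∈q u∈ u∉X) (x∈p∪q∧x∉p⇒x∈q v∈ v∉X)
                              (*-cancelˡ-≡ (s u) (s v) 2 (suc-injective eq))

PairwiseDisjoint : ∀ {n s} → (Fin s → Subset n) → Set
PairwiseDisjoint S = ∀ i j → i ≢ j → Disjoint (S i) (S j)

module _ {n s : ℕ} where

  PairwiseDisjoint-⊆ : ∀ {S S′ : Fin s → Subset n} → (∀ j → S′ j ⊆ S j) →
                       PairwiseDisjoint S → PairwiseDisjoint S′
  PairwiseDisjoint-⊆ S′⊆S disjoint i j i≢j v v∈S′i v∈S′j = disjoint i j i≢j v (S′⊆S i v∈S′i) (S′⊆S j v∈S′j)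

  PairwiseDisjoint-tail : ∀ {S : Fin (suc s) → Subset n} → PairwiseDisjoint S → PairwiseDisjoint (tail S)
  PairwiseDisjoint-tail disjoint i j i≢j = disjoint (suc i) (suc j) (i≢j ∘ Fin.suc-injective)

  PairwiseDisjoint-∷ : ∀ {Y} {S : Fin s → Subset n} → (∀ j → Disjoint Y (S j)) → PairwiseDisjoint S →
                       PairwiseDisjoint (Y ∷ᶠ S)
  PairwiseDisjoint-∷ Y∩S _        zero    zero    0≢0   = contradiction refl 0≢0
  PairwiseDisjoint-∷ Y∩S _        zero    (suc j) _     = Y∩S j
  PairwiseDisjoint-∷ Y∩S _        (suc i) zero    _     = λ v v∈Si v∈Y → Y∩S i v v∈Y v∈Si
  PairwiseDisjoint-∷ _   disjoint (suc i) (suc j) i+≢j+ = disjoint i j (i+≢j+ ∘ cong suc)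

module Omega {n} (T : Tournament n) where

  OmegaLeBy : Subset n → ℕ → (Fin n → ℕ) → Set
  OmegaLeBy X k r = IsOrderingOf X r × CliqueNumLe T X r k

  LargeBackClique : Subset n → (Fin n → ℕ) → ℕ → Set
  LargeBackClique X r m = ∃ λ K → BackClique T X r K × m ≤ ∣ K ∣

  BackClique-restrict : ∀ {X Y r s K K′} → K′ ⊆ K → K′ ⊆ Y →
    (∀ {u v} → u ∈ K′ → v ∈ K′ → s u < s v → r u < r v) →
    BackClique T X r K → BackClique T Y s K′
  BackClique-restrict K′⊆K K′⊆Y mono (_ , back) =
    K′⊆Y , λ u v u∈K′ v∈K′ su<sv → back u v (K′⊆K u∈K′) (K′⊆K v∈K′) (mono u∈K′ v∈K′ su<sv)

  OmegaLeBy-rerank : ∀ {X k r s} → (∀ {u v} → u ∈ X → v ∈ X → r u < r v → s u < s v) →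
                     OmegaLeBy X k r → OmegaLeBy X k s
  OmegaLeBy-rerank mono (ord , cl) =
    IsOrderingOf-rerank mono ord ,
    λ K bc → cl K (BackClique-restrict id (proj₁ bc) (λ u∈K v∈K → mono (proj₁ bc u∈K) (proj₁ bc v∈K)) bc)

  CliqueNumLe-interleave : ∀ {X Y r s k l} → CliqueNumLe T X r k → CliqueNumLe T Y s l →
                           CliqueNumLe T (X ∪ Y) (interleave X r s) (k + l)
  CliqueNumLe-interleave {X} {Y} {r} {s} {k} {l} clX clY K bc = begin
    ∣ K ∣                   ≤⟨ p⊆q⇒∣p∣≤∣q∣ (p⊆p∩q∪p∩∁q K X) ⟩
    ∣ K ∩ X ∪ K ∩ ∁ X ∣     ≤⟨ ∣p∪q∣≤∣p∣+∣q∣ (K ∩ X) (K ∩ ∁ X) ⟩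
    ∣ K ∩ X ∣ + ∣ K ∩ ∁ X ∣ ≤⟨ +-mono-≤ (clX (K ∩ X) inX) (clY (K ∩ ∁ X) inY) ⟩
    k + l                   ∎
    where
    open ≤-Reasoning
    outside : ∀ {v} → v ∈ K ∩ ∁ X → v ∉ X
    outside v∈ = x∈∁p⇒x∉p (proj₂ (x∈p∩q⁻ K (∁ X) v∈))
    inX : BackClique T X r (K ∩ X)
    inX = BackClique-restrict (p∩q⊆p K X) (p∩q⊆q K X)
      (λ u∈ v∈ → interleave-mono-∈ X r s (proj₂ (x∈p∩q⁻ K X u∈)) (proj₂ (x∈p∩q⁻ K X v∈))) bc
    inY : BackClique T Y s (K ∩ ∁ X)
    inY = BackClique-restrict (p∩q⊆p K (∁ X))
      (λ v∈ → x∈p∪q∧x∉p⇒x∈q (proj₁ bc (p∩q⊆p K (∁ X) v∈)) (outside v∈))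
      (λ u∈ v∈ → interleave-mono-∉ X r s (outside u∈) (outside v∈)) bc

  backClique? : ∀ X r K → Dec (BackClique T X r K)
  backClique? X r K = (K ⊆? X) ×-dec all? λ u → all? λ v →
    (u ∈? K) →-dec ((v ∈? K) →-dec ((r u <? r v) →-dec (adj T v u ≟ᵇ true)))

  largeBackClique? : ∀ X r m → Dec (LargeBackClique X r m)
  largeBackClique? X r m = anySubset? λ K → backClique? X r K ×-dec (m ≤? ∣ K ∣)

  ¬LargeBackClique⇒CliqueNumLe : ∀ {X r k} → ¬ LargeBackClique X r (suc k) → CliqueNumLe T X r k
  ¬LargeBackClique⇒CliqueNumLe ¬large K bc = ≮⇒≥ λ k<∣K∣ → ¬large (K , bc , k<∣K∣)

  cliqueNumLe? : ∀ X r k → Dec (CliqueNumLe T X r k)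
  cliqueNumLe? X r k = map′ ¬LargeBackClique⇒CliqueNumLe (λ cl (K , bc , k<∣K∣) → <⇒≱ k<∣K∣ (cl K bc))
    (¬? (largeBackClique? X r (suc k)))

  -- Replacing an ordering by the ranks it induces on X keeps it valid, and those ranks are at
  -- most n; so deciding ω(X) ≤ k is a search over the functions Fin n → Fin (suc n).
  OmegaLe-compress : ∀ {X k} → OmegaLe T X k →
                     ∃ λ (i : Fin (suc n ^ n)) → OmegaLeBy X k (toℕ ∘ finToFun i)
  OmegaLe-compress {X} {k} (r , w) = funToFin ρ , OmegaLeBy-rerank mono w
    where
    ρ : Fin n → Fin (suc n)
    ρ v = fromℕ< (s≤s (∣p∣≤n (X ∩ below r v)))
    decode : ∀ v → rank X r v ≡ toℕ (finToFun {suc n} {n} (funToFin ρ) v)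
    decode v = sym (trans (cong toℕ (finToFun-funToFin ρ v)) (toℕ-fromℕ< (s≤s (∣p∣≤n (X ∩ below r v)))))
    mono : ∀ {u v} → u ∈ X → v ∈ X → r u < r v →
           toℕ (finToFun {suc n} {n} (funToFin ρ) u) < toℕ (finToFun {suc n} {n} (funToFin ρ) v)
    mono {u} {v} u∈X _ ru<rv = subst₂ _<_ (decode u) (decode v) (rank-mono {r = r} u∈X ru<rv)

  omegaLe? : ∀ X k → Dec (OmegaLe T X k)
  omegaLe? X k = map′ (λ (i , w) → toℕ ∘ finToFun i , w) OmegaLe-compress
    (any? λ i → isOrderingOf? X (toℕ ∘ finToFun {suc n} {n} i) ×-dec cliqueNumLe? X (toℕ ∘ finToFun i) k)

  OmegaLe-∣∣ : ∀ X → OmegaLe T X ∣ X ∣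
  OmegaLe-∣∣ X = toℕ , (λ _ _ _ _ → toℕ-injective) , λ K bc → p⊆q⇒∣p∣≤∣q∣ (proj₁ bc)

  -- Opaque because unfolding the search makes unification of ω-terms blow up.
  opaque
    ω : Subset n → ℕ
    ω X = proj₁ (least (omegaLe? X) (OmegaLe-∣∣ X))

    OmegaLe-ω : ∀ X → OmegaLe T X (ω X)
    OmegaLe-ω X = proj₁ (proj₂ (least (omegaLe? X) (OmegaLe-∣∣ X)))

    ω-minimal : ∀ X {j} → j < ω X → ¬ OmegaLe T X j
    ω-minimal X = proj₂ (proj₂ (least (omegaLe? X) (OmegaLe-∣∣ X))) _

  OmegaLt-ω : ∀ {X x} → ω X < x → OmegaLt T X x
  OmegaLt-ω {X} ω<x = ω X , ω<x , OmegaLe-ω X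

  ω-least : ∀ X {k} → OmegaLe T X k → ω X ≤ k
  ω-least X w = ≮⇒≥ λ k<ω → ω-minimal X k<ω w

  ω[X]≤∣X∣ : ∀ X → ω X ≤ ∣ X ∣
  ω[X]≤∣X∣ X = ω-least X (OmegaLe-∣∣ X)

  minimal⇒LargeBackClique : ∀ {X r} m → (∀ {j} → j < m → ¬ OmegaLe T X j) →
                            IsOrderingOf X r → LargeBackClique X r m
  minimal⇒LargeBackClique zero _ _ = ⊥ , (⊥⊆ , λ _ _ u∈⊥ → contradiction u∈⊥ ∉⊥) , z≤n
  minimal⇒LargeBackClique {X} {r} (suc k) none ord = decidable-stable (largeBackClique? X r (suc k))
    λ ¬large → none ≤-refl (r , ord , ¬LargeBackClique⇒CliqueNumLe ¬large)

  OmegaEq-ω : ∀ X → OmegaEq T X (ω X)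
  OmegaEq-ω X = OmegaLe-ω X , λ r ord → minimal⇒LargeBackClique (ω X) (ω-minimal X) ord

  ω-mono : ∀ {X Y} → Y ⊆ X → ω Y ≤ ω X
  ω-mono {X} {Y} Y⊆X with OmegaLe-ω X
  ... | r , ord , cl = ω-least Y (r , IsOrderingOf-⊆ Y⊆X ord ,
          λ K bc → cl K (BackClique-restrict id (λ k∈K → Y⊆X (proj₁ bc k∈K)) (λ _ _ → id) bc))

  ω[X∪Y]≤ω[X]+ω[Y] : ∀ X Y → ω (X ∪ Y) ≤ ω X + ω Y
  ω[X∪Y]≤ω[X]+ω[Y] X Y with OmegaLe-ω X | OmegaLe-ω Y
  ... | r , ordX , clX | s , ordY , clY =
    ω-least (X ∪ Y)
      (interleave X r s , IsOrderingOf-interleave X r s ordX ordY , CliqueNumLe-interleave clX clY)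

  ω[X]≤ω[Y]+ω[X∩∁Y] : ∀ X Y → ω X ≤ ω Y + ω (X ∩ ∁ Y)
  ω[X]≤ω[Y]+ω[X∩∁Y] X Y = begin
    ω X                         ≤⟨ ω-mono (p⊆p∩q∪p∩∁q X Y) ⟩
    ω (X ∩ Y ∪ X ∩ ∁ Y)         ≤⟨ ω[X∪Y]≤ω[X]+ω[Y] (X ∩ Y) (X ∩ ∁ Y) ⟩
    ω (X ∩ Y) + ω (X ∩ ∁ Y)     ≤⟨ +-monoˡ-≤ (ω (X ∩ ∁ Y)) (ω-mono (p∩q⊆q X Y)) ⟩
    ω Y + ω (X ∩ ∁ Y)           ∎
    where open ≤-Reasoning

  ω-nonempty : ∀ {X} → 0 < ω X → Nonempty X
  ω-nonempty {X} 0<ω with nonempty? X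
  ... | yes nonempty = nonempty
  ... | no  empty    = contradiction ω≤0 (<⇒≱ 0<ω)
    where
    ω≤0 : ω X ≤ 0
    ω≤0 = ≤-trans (ω[X]≤∣X∣ X) (≤-reflexive (trans (cong ∣_∣ (Empty-unique empty)) (∣⊥∣≡0 n)))

  ω[X]≤1+ω[X-v] : ∀ X v → ω X ≤ suc (ω (X - v))
  ω[X]≤1+ω[X-v] X v = begin
    ω X                   ≤⟨ ω-mono cover ⟩
    ω (⁅ v ⁆ ∪ (X - v))   ≤⟨ ω[X∪Y]≤ω[X]+ω[Y] ⁅ v ⁆ (X - v) ⟩
    ω ⁅ v ⁆ + ω (X - v)   ≤⟨ +-monoˡ-≤ (ω (X - v)) (≤-trans (ω[X]≤∣X∣ ⁅ v ⁆) (≤-reflexive (∣⁅x⁆∣≡1 v))) ⟩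
    suc (ω (X - v))       ∎
    where
    open ≤-Reasoning
    cover : X ⊆ ⁅ v ⁆ ∪ (X - v)
    cover {u} u∈X with u ≟ᶠ v
    ... | yes refl = x∈p∪q⁺ (inj₁ (x∈⁅x⁆ v))
    ... | no  u≢v  = x∈p∪q⁺ (inj₂ (x∈p∧x≢y⇒x∈p-y u∈X u≢v))

  ω-intermediate : ∀ X {m} → m ≤ ω X → ∃ λ Y → Y ⊆ X × ω Y ≡ m
  ω-intermediate X = shrink ∣ X ∣ X ≤-refl
    where
    shrink : ∀ k X {m} → ∣ X ∣ ≤ k → m ≤ ω X → ∃ λ Y → Y ⊆ X × ω Y ≡ m
    shrink k X ∣X∣≤k m≤ω with m≤n⇒m<n∨m≡n m≤ω
    ... | inj₂ m≡ω = X , id , sym m≡ω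
    shrink zero X ∣X∣≤0 _ | inj₁ m<ω = contradiction (≤-trans (ω[X]≤∣X∣ X) ∣X∣≤0) (<⇒≱ (≤-<-trans z≤n m<ω))
    shrink (suc k) X ∣X∣≤1+k _ | inj₁ m<ω with ω-nonempty (≤-<-trans z≤n m<ω)
    ... | v , v∈X with shrink k (X - v) (m<1+n⇒m≤n (<-≤-trans (x∈p⇒∣p-x∣<∣p∣ v∈X) ∣X∣≤1+k))
                         (m<1+n⇒m≤n (<-≤-trans m<ω (ω[X]≤1+ω[X-v] X v)))
    ... | Y , Y⊆X-v , ωY≡m = Y , (λ y∈Y → p─q⊆p X ⁅ v ⁆ (Y⊆X-v y∈Y)) , ωY≡m

  ω-avoid : ∀ {s k X} (F : Fin s → Subset n) → (∀ j → ω (F j) ≤ k) → s * k < ω X →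
            ∃ λ v → v ∈ X × ∀ j → v ∉ F j
  ω-avoid {zero} F _ 0<ω = proj₁ (ω-nonempty 0<ω) , proj₂ (ω-nonempty 0<ω) , λ ()
  ω-avoid {suc s} {k} {X} F small sk<ω =
    let v , v∈X∖F₀ , v∉F₊ = ω-avoid (tail F) (small ∘ suc) remaining
    in  v , proj₁ (x∈p∩q⁻ X _ v∈X∖F₀) , λ { zero → x∈∁p⇒x∉p (proj₂ (x∈p∩q⁻ X _ v∈X∖F₀)) ; (suc j) → v∉F₊ j }
    where
    open ≤-Reasoning
    remaining : s * k < ω (X ∩ ∁ (F zero))
    remaining = +-cancelˡ-< k (s * k) _ (begin-strict
      k + s * k                       <⟨ sk<ω ⟩
      ω X                             ≤⟨ ω[X]≤ω[Y]+ω[X∩∁Y] X (F zero) ⟩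
      ω (F zero) + ω (X ∩ ∁ (F zero))   ≤⟨ +-monoˡ-≤ _ (small zero) ⟩
      k + ω (X ∩ ∁ (F zero))            ∎)

  ω-partition : ∀ s {N X} → s * N ≤ ω X →
                ∃ λ (S : Fin s → Subset n) → PairwiseDisjoint S × (∀ j → N ≤ ω (S j)) × (∀ j → S j ⊆ X)
  ω-partition zero _ = (λ ()) , (λ ()) , (λ ()) , (λ ())
  ω-partition (suc s) {N} {X} sN≤ω =
    let Y , Y⊆X , ωY≡N = ω-intermediate X (≤-trans (m≤m+n N (s * N)) sN≤ω)
        S , disjoint , large , S⊆X∖Y = ω-partition s {N} {X ∩ ∁ Y} (remaining ωY≡N)
        S⊆X : ∀ j → S j ⊆ X
        S⊆X j v∈Sj = proj₁ (x∈p∩q⁻ X (∁ Y) (S⊆X∖Y j v∈Sj))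
        Y-disjoint-S : ∀ j → Disjoint Y (S j)
        Y-disjoint-S j v v∈Y v∈Sj = x∈∁p⇒x∉p (proj₂ (x∈p∩q⁻ X (∁ Y) (S⊆X∖Y j v∈Sj))) v∈Y
    in  Y ∷ᶠ S ,
        PairwiseDisjoint-∷ Y-disjoint-S disjoint ,
        (λ { zero → ≤-reflexive (sym ωY≡N) ; (suc j) → large j }) ,
        (λ { zero → Y⊆X ; (suc j) → S⊆X j })
    where
    open ≤-Reasoning
    remaining : ∀ {Y} → ω Y ≡ N → s * N ≤ ω (X ∩ ∁ Y)
    remaining {Y} ωY≡N = +-cancelˡ-≤ N _ _ (begin
      N + s * N           ≤⟨ sN≤ω ⟩
      ω X                 ≤⟨ ω[X]≤ω[Y]+ω[X∩∁Y] X Y ⟩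
      ω Y + ω (X ∩ ∁ Y)   ≡⟨ cong (_+ ω (X ∩ ∁ Y)) ωY≡N ⟩
      N + ω (X ∩ ∁ Y)     ∎)

delete₀ : ∀ {s} → Tournament (suc s) → Tournament s
delete₀ Q = record
  { adj    = λ i j → adj Q (suc i) (suc j)
  ; irrefl = λ i → irrefl Q (suc i)
  ; oneArc = λ i j i≢j → oneArc Q (suc i) (suc j) (i≢j ∘ Fin.suc-injective)
  }

module _ {n} (T : Tournament n) where

  Nbr : Bool → Fin n → Subset n
  Nbr true  = N⁺ T
  Nbr false = N⁻ T

  ∈Nbr⇒adj : ∀ b {u v} → u ≢ v → u ∈ Nbr b v → adj T v u ≡ b
  ∈Nbr⇒adj true  {v = v} _   u∈ = ∈-tabulate⁻ (adj T v) u∈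
  ∈Nbr⇒adj false {u} {v} u≢v u∈ =
    trans (oneArc T v u (u≢v ∘ sym)) (cong not (∈-tabulate⁻ (λ w → adj T w v) u∈))

  Transversal : ∀ {s} → Tournament s → (Fin s → Subset n) → Set
  Transversal {s} Q S = Σ (Fin s → Fin n) λ φ → (∀ j → φ j ∈ S j) × (∀ i j → adj T (φ i) (φ j) ≡ adj Q i j)

  Transversal-∷ : ∀ {s} {Q : Tournament (suc s)} {S : Fin (suc s) → Subset n} {v S′} →
                  v ∈ S zero → (∀ j → v ∉ S (suc j)) →
                  (∀ j → S′ j ⊆ Nbr (adj Q zero (suc j)) v) → (∀ j → S′ j ⊆ S (suc j)) →
                  Transversal (delete₀ Q) S′ → Transversal Q S
  Transversal-∷ {Q = Q} {S} {v} v∈S₀ v∉S₊ S′⊆Nbr S′⊆S₊ (φ , φ∈S′ , φ-adj) = v ∷ᶠ φ , ∈S , adj≡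
    where
    φ≢v : ∀ j → φ j ≢ v
    φ≢v j φj≡v = v∉S₊ j (subst (_∈ S (suc j)) φj≡v (S′⊆S₊ j (φ∈S′ j)))
    v→φ : ∀ j → adj T v (φ j) ≡ adj Q zero (suc j)
    v→φ j = ∈Nbr⇒adj _ (φ≢v j) (S′⊆Nbr j (φ∈S′ j))
    ∈S : ∀ j → (v ∷ᶠ φ) j ∈ S j
    ∈S zero    = v∈S₀
    ∈S (suc j) = S′⊆S₊ j (φ∈S′ j)
    adj≡ : ∀ i j → adj T ((v ∷ᶠ φ) i) ((v ∷ᶠ φ) j) ≡ adj Q i j
    adj≡ zero    zero    = trans (irrefl T v) (sym (irrefl Q zero))
    adj≡ zero    (suc j) = v→φ j
    adj≡ (suc i) zero    = begin
      adj T (φ i) v            ≡⟨ oneArc T (φ i) v (φ≢v i) ⟩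
      not (adj T v (φ i))      ≡⟨ cong not (v→φ i) ⟩
      not (adj Q zero (suc i)) ≡⟨ oneArc Q (suc i) zero (λ ()) ⟨
      adj Q (suc i) zero       ∎
      where open ≡-Reasoning
    adj≡ (suc i) (suc j) = φ-adj i j

  Transversal⇒ContainsCopy : ∀ {s} {Q : Tournament s} {S} → PairwiseDisjoint S →
                             Transversal Q S → ContainsCopy T Q
  Transversal⇒ContainsCopy {S = S} disjoint (φ , φ∈S , φ-adj) = φ , injective , φ-adj
    where
    injective : ∀ i j → φ i ≡ φ j → i ≡ j
    injective i j φi≡φj with i ≟ᶠ j
    ... | yes i≡j = i≡j
    ... | no  i≢j = contradiction (subst (_∈ S j) (sym φi≡φj) (φ∈S j)) (disjoint i j i≢j (φ i) (φ∈S i))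

module _ (f : ℕ → ℕ) (c : ℕ) where

  bound : ℕ → ℕ
  bound zero    = 0
  bound (suc s) = suc (suc s * f (bound s + c))

  module _ {n} (T : Tournament n) where
    open Omega T

    SparsePair : Set
    SparsePair = Σ ℕ λ x → c ≤ x × Σ (Subset n) λ A → Σ (Subset n) λ B →
      Disjoint A B × OmegaEq T A (f x) × OmegaEq T B (f x) ×
      ((∀ v → v ∈ A → OmegaLt T (N⁻ T v ∩ B) x) ⊎
       (∀ v → v ∈ A → OmegaLt T (N⁺ T v ∩ B) x))

    sparsePair : ∀ {x A B} b → c ≤ x → Disjoint A B → f x ≤ ω A → ω B ≡ f x →
                 (∀ {v} → v ∈ A → ω (Nbr T b v ∩ B) < x) → SparsePair
    sparsePair {x} {A} {B} b c≤x disjoint large ωB≡fx sparse with ω-intermediate A large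
    ... | A′ , A′⊆A , ωA′≡fx =
      x , c≤x , A′ , B , (λ v v∈A′ → disjoint v (A′⊆A v∈A′)) ,
      subst (OmegaEq T A′) ωA′≡fx (OmegaEq-ω A′) , subst (OmegaEq T B) ωB≡fx (OmegaEq-ω B) ,
      side b sparse
      where
      side : ∀ b → (∀ {v} → v ∈ A → ω (Nbr T b v ∩ B) < x) →
             (∀ v → v ∈ A′ → OmegaLt T (N⁻ T v ∩ B) x) ⊎ (∀ v → v ∈ A′ → OmegaLt T (N⁺ T v ∩ B) x)
      side false sparse = inj₁ λ _ v∈A′ → OmegaLt-ω (sparse (A′⊆A v∈A′))
      side true  sparse = inj₂ λ _ v∈A′ → OmegaLt-ω (sparse (A′⊆A v∈A′))

    sparseVertices : Subset n → Bool → Subset n → ℕ → Subset n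
    sparseVertices S₀ b Y x = S₀ ∩ subset (λ v → ω (Nbr T b v ∩ Y) <? x)

    vertex-or-sparsePair : ∀ {s x S₀} (B : Fin s → Subset n) (d : Fin s → Bool) → c ≤ x →
                           (∀ j → Disjoint S₀ (B j)) → (∀ j → ω (B j) ≡ f x) → s * f x < ω S₀ →
                           SparsePair ⊎ ∃ λ v → v ∈ S₀ × ∀ j → x ≤ ω (Nbr T (d j) v ∩ B j)
    vertex-or-sparsePair {s} {x} {S₀} B d c≤x disjoint ωB≡fx large
      with any? (λ j → f x ≤? ω (sparseVertices S₀ (d j) (B j) x))
    ... | yes (j , big) =
      inj₁ (sparsePair (d j) c≤x (λ v v∈ → disjoint j v (p∩q⊆p S₀ _ v∈)) big (ωB≡fx j)
                       (λ v∈ → ∈-subset⁻ (λ v → ω (Nbr T (d j) v ∩ B j) <? x) (p∩q⊆q S₀ _ v∈)))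
    ... | no ¬big
      with ω-avoid (λ j → sparseVertices S₀ (d j) (B j) x) (λ j → <⇒≤ (≰⇒> λ big → ¬big (j , big))) large
    ...   | v , v∈S₀ , v∉sparse = inj₂ (v , v∈S₀ , λ j → ≮⇒≥ λ ω<x →
              v∉sparse j (x∈p∩q⁺ (v∈S₀ , ∈-subset⁺ (λ v → ω (Nbr T (d j) v ∩ B j) <? x) ω<x)))

    transversal-or-sparsePair : ∀ {s} (Q : Tournament s) (S : Fin s → Subset n) → PairwiseDisjoint S →
                                (∀ j → bound s ≤ ω (S j)) → SparsePair ⊎ Transversal T Q S
    transversal-or-sparsePair {zero}  Q S _        _     = inj₂ ((λ ()) , (λ ()) , λ ())
    transversal-or-sparsePair {suc s} Q S disjoint large =
      [ inj₁ , (λ (v , v∈S₀ , dense) → extend v∈S₀ dense) ]′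
      (vertex-or-sparsePair B d (m≤n+m c (bound s)) B-disjoint (proj₂ ∘ proj₂ ∘ Bs) S₀-large)
      where
      x : ℕ
      x = bound s + c
      S₀-large : s * f x < ω (S zero)
      S₀-large = <-≤-trans (s≤s (m≤n+m (s * f x) (f x))) (large zero)
      Bs : ∀ j → ∃ λ Y → Y ⊆ S (suc j) × ω Y ≡ f x
      Bs j = ω-intermediate (S (suc j)) (≤-trans (m≤m+n (f x) (s * f x)) (<⇒≤ (large (suc j))))
      B : Fin s → Subset n
      B = proj₁ ∘ Bs
      B-disjoint : ∀ j → Disjoint (S zero) (B j)
      B-disjoint j v v∈S₀ v∈Bj = disjoint zero (suc j) (λ ()) v v∈S₀ (proj₁ (proj₂ (Bs j)) v∈Bj)
      d : Fin s → Bool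
      d j = adj Q zero (suc j)
      extend : ∀ {v} → v ∈ S zero → (∀ j → x ≤ ω (Nbr T (d j) v ∩ B j)) → SparsePair ⊎ Transversal T Q S
      extend {v} v∈S₀ dense =
        map₂ (Transversal-∷ T {Q = Q} v∈S₀ (λ j → disjoint zero (suc j) (λ ()) v v∈S₀)
                (λ j → p∩q⊆p _ (B j)) S′⊆S₊)
          (transversal-or-sparsePair (delete₀ Q) S′
            (PairwiseDisjoint-⊆ S′⊆S₊ (PairwiseDisjoint-tail disjoint))
            (λ j → ≤-trans (m≤m+n (bound s) c) (dense j)))
        where
        S′ : Fin s → Subset n
        S′ j = Nbr T (d j) v ∩ B j
        S′⊆S₊ : ∀ j → S′ j ⊆ S (suc j)
        S′⊆S₊ j w∈ = proj₁ (proj₂ (Bs j)) (p∩q⊆q _ (B j) w∈)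

lemma5p2 : (f : ℕ → ℕ) → Nondecreasing f → (c q : ℕ) →
    Σ ℕ λ C → ∀ (Q : Tournament q) (n : ℕ) (T : Tournament n) →
      OmegaLt T Full C ⊎
      (ContainsCopy T Q ⊎
       Σ ℕ λ x → c ≤ x × Σ (Subset n) λ A → Σ (Subset n) λ B →
         Disjoint A B × OmegaEq T A (f x) × OmegaEq T B (f x) ×
         ((∀ v → v ∈ A → OmegaLt T (N⁻ T v ∩ B) x) ⊎
          (∀ v → v ∈ A → OmegaLt T (N⁺ T v ∩ B) x)))
lemma5p2 f _ c q = q * bound f c q , outcome
  where
  outcome : ∀ (Q : Tournament q) n (T : Tournament n) →
            OmegaLt T Full (q * bound f c q) ⊎ (ContainsCopy T Q ⊎ SparsePair f c T)
  outcome Q n T with Omega.ω T Full <? q * bound f c q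
  ... | yes small = inj₁ (Omega.OmegaLt-ω T small)
  ... | no ¬small with Omega.ω-partition T q {bound f c q} (≮⇒≥ ¬small)
  ...   | S , disjoint , large , _ =
    inj₂ ([ inj₂ , inj₁ ∘ Transversal⇒ContainsCopy T {Q = Q} disjoint ]′
            (transversal-or-sparsePair f c T Q S disjoint large))
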